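{- In the calculus $\mathcal{H}\mathbf{K}\mathsf{biG}^{\mathsf c}$, the axiom schema ${\sim}\triangle(\lozenge\phi\to\lozenge\chi)\to\lozenge{\sim}\triangle(\phi\to\chi)$ is redundant, i.e., all its instances are derivable from the remaining axioms and rules of $\mathcal{H}\mathbf{K}\mathsf{biG}^{\mathsf c}$.
   Context: Language $\mathcal{L}_{\triangle,\Box,\lozenge}$: generated from variables by ${\sim},\triangle,\wedge,\vee,\to,\Box,\lozenge$; $\mathbf1:=p\to p$, $\mathbf0:={\sim}\mathbf1$. $\mathcal{H}\mathsf{G}\triangle$ has axiom schemas: $(\phi\to\chi)\to((\chi\to\psi)\to(\phi\to\psi))$; $\phi\to(\phi\vee\chi)$, $\chi\to(\phi\vee\chi)$, $(\phi\to\psi)\to((\chi\to\psi)\to((\phi\vee\chi)\to\psi))$; $(\phi\wedge\chi)\to\phi$, $(\phi\wedge\chi)\to\chi$, $(\phi\to\chi)\to((\phi\to\psi)\to(\phi\to(\chi\wedge\psi)))$; $(\phi\to(\chi\to\psi))\to((\phi\wedge\chi)\to\psi)$, $((\phi\wedge\chi)\to\psi)\to(\phi\to(\chi\to\psi))$; ${\sim}\phi\to(\phi\to\chi)$; $(\phi\to\chi)\vee(\chi\to\phi)$; $\triangle\phi\vee{\sim}\triangle\phi$; $\triangle(\phi\to\chi)\to(\triangle\phi\to\triangle\chi)$, $\triangle(\phi\vee\chi)\to(\triangle\phi\vee\triangle\chi)$; $\triangle\phi\to\phi$, $\triangle\phi\to\triangle\triangle\phi$; rules modus ponens and $\triangle$-necessitation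 (from $\vdash\phi$ infer $\vdash\triangle\phi$). $\mathcal{H}\mathbf{K}\mathsf{biG}^{\mathsf c}$ consists of: all substitution instances of $\mathcal{H}\mathsf{G}\triangle$ theorems and rules; ${\sim}\lozenge\mathbf0$; $\Box(\phi\to\chi)\to(\Box\phi\to\Box\chi)$; $\lozenge(\phi\vee\chi)\to(\lozenge\phi\vee\lozenge\chi)$; $\lozenge(\phi\to\chi)\to(\Box\phi\to\lozenge\chi)$; $(\lozenge\phi\to\Box\chi)\to\Box(\phi\to\chi)$; ${\sim}\triangle(\lozenge\phi\to\lozenge\chi)\to\lozenge{\sim}\triangle(\phi\to\chi)$; $\Box(\phi\vee\chi)\to(\Box\phi\vee\lozenge\chi)$; $\triangle\Box\phi\to\Box\triangle\phi$; rules: from $\vdash\phi$ infer $\vdash\Box\phi$; from $\vdash\phi\to\chi$ infer $\vdash\lozenge\phi\to\lozenge\chi$ (modal and $\triangle$ rules applied only to theorems). -}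

module Defs where

open import Data.Nat using (ℕ)
open import Data.Bool using (Bool; true; false)
open import Relation.Binary.PropositionalEquality using (_≡_)

data Fm : Set where
  var  : ℕ → Fm
  ∼_   : Fm → Fm
  △_   : Fm → Fm
  _∧_  : Fm → Fm → Fm
  _∨_  : Fm → Fm → Fm
  _⇒_  : Fm → Fm → Fm
  □_   : Fm → Fm
  ◇_   : Fm → Fm

infixr 4 _⇒_
infixr 5 _∨_
infixr 6 _∧_
infix 7 ∼_ △_ □_ ◇_

𝟏 : Fm
𝟏 = var 0 ⇒ var 0

𝟎 : Fm
𝟎 = ∼ 𝟏

data Fm△ : Set where
  var  : ℕ → Fm△
  ∼_   : Fm△ → Fm△
  △_   : Fm△ → Fm△
  _∧_  : Fm△ → Fm△ → Fm△
  _∨_  : Fm△ → Fm△ → Fm△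
  _⇒_  : Fm△ → Fm△ → Fm△

data ⊢G△ : Fm△ → Set where
  ax1  : ∀ φ χ ψ → ⊢G△ ((φ ⇒ χ) ⇒ ((χ ⇒ ψ) ⇒ (φ ⇒ ψ)))
  ax2  : ∀ φ χ → ⊢G△ (φ ⇒ (φ ∨ χ))
  ax3  : ∀ φ χ → ⊢G△ (χ ⇒ (φ ∨ χ))
  ax4  : ∀ φ χ ψ → ⊢G△ ((φ ⇒ ψ) ⇒ ((χ ⇒ ψ) ⇒ ((φ ∨ χ) ⇒ ψ)))
  ax5  : ∀ φ χ → ⊢G△ ((φ ∧ χ) ⇒ φ)
  ax6  : ∀ φ χ → ⊢G△ ((φ ∧ χ) ⇒ χ)
  ax7  : ∀ φ χ ψ → ⊢G△ ((φ ⇒ χ) ⇒ ((φ ⇒ ψ) ⇒ (φ ⇒ (χ ∧ ψ))))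
  ax8  : ∀ φ χ ψ → ⊢G△ ((φ ⇒ (χ ⇒ ψ)) ⇒ ((φ ∧ χ) ⇒ ψ))
  ax9  : ∀ φ χ ψ → ⊢G△ (((φ ∧ χ) ⇒ ψ) ⇒ (φ ⇒ (χ ⇒ ψ)))
  ax10 : ∀ φ χ → ⊢G△ (∼ φ ⇒ (φ ⇒ χ))
  ax11 : ∀ φ χ → ⊢G△ ((φ ⇒ χ) ∨ (χ ⇒ φ))
  ax12 : ∀ φ → ⊢G△ (△ φ ∨ ∼ △ φ)
  ax13 : ∀ φ χ → ⊢G△ (△ (φ ⇒ χ) ⇒ (△ φ ⇒ △ χ))
  ax14 : ∀ φ χ → ⊢G△ (△ (φ ∨ χ) ⇒ (△ φ ∨ △ χ))
  ax15 : ∀ φ → ⊢G△ (△ φ ⇒ φ)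
  ax16 : ∀ φ → ⊢G△ (△ φ ⇒ △ △ φ)
  mp   : ∀ {φ χ} → ⊢G△ φ → ⊢G△ (φ ⇒ χ) → ⊢G△ χ
  nec△ : ∀ {φ} → ⊢G△ φ → ⊢G△ (△ φ)

sub : (ℕ → Fm) → Fm△ → Fm
sub σ (var n) = σ n
sub σ (∼ φ)   = ∼ sub σ φ
sub σ (△ φ)   = △ sub σ φ
sub σ (φ ∧ χ) = sub σ φ ∧ sub σ χ
sub σ (φ ∨ χ) = sub σ φ ∨ sub σ χ
sub σ (φ ⇒ χ) = sub σ φ ⇒ sub σ χ

-- H K biG^c, parametrised by whether the axiom schema
--   ∼△(◇φ → ◇χ) → ◇∼△(φ → χ)
-- is included (true = full calculus, false = calculus without it).
data ⊢K (withAx : Bool) : Fm → Set where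
  gInst : ∀ σ {φ} → ⊢G△ φ → ⊢K withAx (sub σ φ)
  mp    : ∀ {φ χ} → ⊢K withAx φ → ⊢K withAx (φ ⇒ χ) → ⊢K withAx χ
  nec△  : ∀ {φ} → ⊢K withAx φ → ⊢K withAx (△ φ)
  k◇0   : ⊢K withAx (∼ ◇ 𝟎)
  k□    : ∀ φ χ → ⊢K withAx (□ (φ ⇒ χ) ⇒ (□ φ ⇒ □ χ))
  k◇∨   : ∀ φ χ → ⊢K withAx (◇ (φ ∨ χ) ⇒ (◇ φ ∨ ◇ χ))
  k◇⇒   : ∀ φ χ → ⊢K withAx (◇ (φ ⇒ χ) ⇒ (□ φ ⇒ ◇ χ))
  fs    : ∀ φ χ → ⊢K withAx ((◇ φ ⇒ □ χ) ⇒ □ (φ ⇒ χ))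
  cdd   : ∀ φ χ → withAx ≡ true → ⊢K withAx (∼ △ (◇ φ ⇒ ◇ χ) ⇒ ◇ ∼ △ (φ ⇒ χ))
  □∨    : ∀ φ χ → ⊢K withAx (□ (φ ∨ χ) ⇒ (□ φ ∨ ◇ χ))
  △□    : ∀ φ → ⊢K withAx (△ □ φ ⇒ □ △ φ)
  nec□  : ∀ {φ} → ⊢K withAx φ → ⊢K withAx (□ φ)
  mon◇  : ∀ {φ χ} → ⊢K withAx (φ ⇒ χ) → ⊢K withAx (◇ φ ⇒ ◇ χ)

{-# OPTIONS --safe #-}
-- Put θ := φ ⇒ χ. Excluded middle for △θ gives □△θ ∨ ◇∼△θ (by □-necessitation and
-- □(φ ∨ χ) ⇒ □φ ∨ ◇χ), and since △ distributes over ∨ also △□△θ ∨ △◇∼△θ.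
-- In the second case ◇∼△θ holds outright. In the first, □△θ already yields
-- ◇φ ⇒ ◇χ: from φ we get χ ∨ ∼△θ, so ◇φ ⇒ ◇χ ∨ ◇∼△θ, and ◇∼△θ together with
-- □△θ gives ◇𝟎, which is refuted. Hence △(◇φ ⇒ ◇χ), contradicting ∼△(◇φ ⇒ ◇χ).
module Submission where

open import Defs
open import Data.Nat using (ℕ; zero; suc)
open import Data.Bool using (Bool; false)
open import Data.List using (List; []; _∷_)
open import Data.List.Membership.Propositional using (_∈_)
open import Data.List.Relation.Unary.Any using (here; there)
open import Relation.Binary.PropositionalEquality using (refl)

module Calculus (withAx : Bool) where

  ⊢_ : Fm → Set
  ⊢_ = ⊢K withAx

  infix 2 ⊢_

  private
    assign : Fm → Fm → Fm → ℕ → Fm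
    assign a b c zero          = a
    assign a b c (suc zero)    = b
    assign a b c (suc (suc _)) = c

    p q r : Fm△
    p = var 0
    q = var 1
    r = var 2

  ⇒-trans-ax : ∀ a b c → ⊢ (a ⇒ b) ⇒ ((b ⇒ c) ⇒ (a ⇒ c))
  ⇒-trans-ax a b c = gInst (assign a b c) (ax1 p q r)

  ∨-introˡ : ∀ a b → ⊢ a ⇒ a ∨ b
  ∨-introˡ a b = gInst (assign a b b) (ax2 p q)

  ∨-introʳ : ∀ a b → ⊢ b ⇒ a ∨ b
  ∨-introʳ a b = gInst (assign a b b) (ax3 p q)

  ∨-elim-ax : ∀ a b c → ⊢ (a ⇒ c) ⇒ ((b ⇒ c) ⇒ (a ∨ b ⇒ c))
  ∨-elim-ax a b c = gInst (assign a b c) (ax4 p q r)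

  ∧-elimˡ : ∀ a b → ⊢ a ∧ b ⇒ a
  ∧-elimˡ a b = gInst (assign a b b) (ax5 p q)

  ∧-elimʳ : ∀ a b → ⊢ a ∧ b ⇒ b
  ∧-elimʳ a b = gInst (assign a b b) (ax6 p q)

  ∧-intro-ax : ∀ a b c → ⊢ (a ⇒ b) ⇒ ((a ⇒ c) ⇒ (a ⇒ b ∧ c))
  ∧-intro-ax a b c = gInst (assign a b c) (ax7 p q r)

  uncurry-ax : ∀ a b c → ⊢ (a ⇒ (b ⇒ c)) ⇒ (a ∧ b ⇒ c)
  uncurry-ax a b c = gInst (assign a b c) (ax8 p q r)

  curry-ax : ∀ a b c → ⊢ (a ∧ b ⇒ c) ⇒ (a ⇒ (b ⇒ c))
  curry-ax a b c = gInst (assign a b c) (ax9 p q r)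

  ∼-elim : ∀ a b → ⊢ ∼ a ⇒ (a ⇒ b)
  ∼-elim a b = gInst (assign a b b) (ax10 p q)

  △-excluded-middle : ∀ a → ⊢ △ a ∨ ∼ △ a
  △-excluded-middle a = gInst (assign a a a) (ax12 p)

  △-distrib-⇒ : ∀ a b → ⊢ △ (a ⇒ b) ⇒ (△ a ⇒ △ b)
  △-distrib-⇒ a b = gInst (assign a b b) (ax13 p q)

  △-distrib-∨ : ∀ a b → ⊢ △ (a ∨ b) ⇒ △ a ∨ △ b
  △-distrib-∨ a b = gInst (assign a b b) (ax14 p q)

  △-elim : ∀ a → ⊢ △ a ⇒ a
  △-elim a = gInst (assign a a a) (ax15 p)

  ⇒-refl : ∀ a → ⊢ a ⇒ a
  ⇒-refl a = mp (∨-introˡ 𝟏 𝟏) (mp (∧-elimʳ (𝟏 ⇒ 𝟏 ∨ 𝟏) a) (curry-ax _ a a))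

  ⇒-const : ∀ a b → ⊢ a ⇒ (b ⇒ a)
  ⇒-const a b = mp (∧-elimˡ a b) (curry-ax a b a)

  ⇒-trans : ∀ {a b c} → ⊢ a ⇒ b → ⊢ b ⇒ c → ⊢ a ⇒ c
  ⇒-trans {a} {b} {c} a⇒b b⇒c = mp b⇒c (mp a⇒b (⇒-trans-ax a b c))

  ⇒-monoʳ : ∀ a {b c} → ⊢ b ⇒ c → ⊢ (a ⇒ b) ⇒ (a ⇒ c)
  ⇒-monoʳ a {b} {c} b⇒c = ⇒-trans pair compose
    where
    pair : ⊢ (a ⇒ b) ⇒ (a ⇒ b) ∧ (b ⇒ c)
    pair = mp (mp b⇒c (⇒-const (b ⇒ c) (a ⇒ b)))
              (mp (⇒-refl (a ⇒ b)) (∧-intro-ax (a ⇒ b) (a ⇒ b) (b ⇒ c)))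
    compose : ⊢ (a ⇒ b) ∧ (b ⇒ c) ⇒ (a ⇒ c)
    compose = mp (⇒-trans-ax a b c) (uncurry-ax (a ⇒ b) (b ⇒ c) (a ⇒ c))

  ⇒-distrib : ∀ a b c → ⊢ (c ⇒ (a ⇒ b)) ⇒ ((c ⇒ a) ⇒ (c ⇒ b))
  ⇒-distrib a b c = ⇒-trans (∧-intro-ax c (a ⇒ b) a) (⇒-monoʳ (c ⇒ a) (⇒-monoʳ c modus-ponens))
    where
    modus-ponens : ⊢ (a ⇒ b) ∧ a ⇒ b
    modus-ponens = mp (⇒-refl (a ⇒ b)) (uncurry-ax (a ⇒ b) a b)

  △-mono : ∀ {a b} → ⊢ a ⇒ b → ⊢ △ a ⇒ △ b
  △-mono {a} {b} a⇒b = mp (nec△ a⇒b) (△-distrib-⇒ a b)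

  infix 2 _⊩_

  data _⊩_ (Γ : List Fm) : Fm → Set where
    hyp : ∀ {a} → a ∈ Γ → Γ ⊩ a
    thm : ∀ {a} → ⊢ a → Γ ⊩ a
    _·_ : ∀ {a b} → Γ ⊩ a ⇒ b → Γ ⊩ a → Γ ⊩ b

  infixl 5 _·_

  #0 : ∀ {Γ a} → a ∷ Γ ⊩ a
  #0 = hyp (here refl)

  #1 : ∀ {Γ a b} → b ∷ a ∷ Γ ⊩ a
  #1 = hyp (there (here refl))

  #2 : ∀ {Γ a b c} → c ∷ b ∷ a ∷ Γ ⊩ a
  #2 = hyp (there (there (here refl)))

  ⇒-intro : ∀ {Γ a b} → a ∷ Γ ⊩ b → Γ ⊩ a ⇒ b
  ⇒-intro {a = a} (hyp (here refl)) = thm (⇒-refl a)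
  ⇒-intro {a = a} (hyp (there b∈Γ)) = thm (⇒-const _ a) · hyp b∈Γ
  ⇒-intro {a = a} (thm ⊢b)          = thm (mp ⊢b (⇒-const _ a))
  ⇒-intro {a = a} (_·_ {c} {b} f x) = thm (⇒-distrib c b a) · ⇒-intro f · ⇒-intro x

  closed : ∀ {a} → [] ⊩ a → ⊢ a
  closed (hyp ())
  closed (thm ⊢a) = ⊢a
  closed (f · x)  = mp (closed x) (closed f)

  ∨-elim : ∀ {Γ a b c} → Γ ⊩ a ∨ b → a ∷ Γ ⊩ c → b ∷ Γ ⊩ c → Γ ⊩ c
  ∨-elim {a = a} {b} {c} a∨b ac bc = thm (∨-elim-ax a b c) · ⇒-intro ac · ⇒-intro bc · a∨b

  ◇𝟎-elim : ∀ a → ⊢ ◇ 𝟎 ⇒ a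
  ◇𝟎-elim a = mp k◇0 (∼-elim (◇ 𝟎) a)

  ◇∼-□-elim : ∀ a b → ⊢ ◇ ∼ a ⇒ (□ a ⇒ b)
  ◇∼-□-elim a b = ⇒-trans (⇒-trans (mon◇ (∼-elim a 𝟎)) (k◇⇒ a 𝟎)) (⇒-monoʳ (□ a) (◇𝟎-elim b))

  ⇒-△-split : ∀ a b → ⊢ a ⇒ b ∨ ∼ △ (a ⇒ b)
  ⇒-△-split a b = closed (⇒-intro (∨-elim (thm (△-excluded-middle (a ⇒ b)))
    (thm (∨-introˡ b _) · (thm (△-elim (a ⇒ b)) · #0 · #1))
    (thm (∨-introʳ b _) · #0)))

  ◇-⇒-△-split : ∀ a b → ⊢ ◇ a ⇒ ◇ b ∨ ◇ ∼ △ (a ⇒ b)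
  ◇-⇒-△-split a b = ⇒-trans (mon◇ (⇒-△-split a b)) (k◇∨ b (∼ △ (a ⇒ b)))

  □△-⇒-◇-mono : ∀ a b → ⊢ □ △ (a ⇒ b) ⇒ (◇ a ⇒ ◇ b)
  □△-⇒-◇-mono a b = closed (⇒-intro (⇒-intro (∨-elim (thm (◇-⇒-△-split a b) · #0)
    #0
    (thm (◇∼-□-elim (△ (a ⇒ b)) (◇ b)) · #0 · #2))))

  □△-or-◇∼△ : ∀ a → ⊢ □ △ a ∨ ◇ ∼ △ a
  □△-or-◇∼△ a = mp (nec□ (△-excluded-middle a)) (□∨ (△ a) (∼ △ a))

  △□△-or-△◇∼△ : ∀ a → ⊢ △ □ △ a ∨ △ ◇ ∼ △ a
  △□△-or-△◇∼△ a = mp (nec△ (□△-or-◇∼△ a)) (△-distrib-∨ (□ △ a) (◇ ∼ △ a))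

open Calculus false

proposition3p2 : ∀ φ χ → ⊢K false (∼ △ (◇ φ ⇒ ◇ χ) ⇒ ◇ ∼ △ (φ ⇒ χ))
proposition3p2 φ χ = closed (⇒-intro (∨-elim (thm (△□△-or-△◇∼△ (φ ⇒ χ)))
  (thm (∼-elim _ _) · #1 · (thm (△-mono (□△-⇒-◇-mono φ χ)) · #0))
  (thm (△-elim _) · #0)))
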